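{- For every $n\ge 2$, the maximum cardinality $\gamma_I(n)$ of a minimal inversion-complete subset of $S_n$ satisfies $\gamma_I(n)\le\lfloor n^2/4\rfloor$.
   Context: $S_n$ is the set of permutations of $[n]$; $\pi$ covers the ordered pair $(\pi(k),\pi(l))$ iff $k<l$. An inversion is a pair $(j,i)$ with $1\le i<j\le n$. $Q\subseteq S_n$ is inversion-complete if every inversion is covered by some element of $Q$, and minimally inversion-complete if in addition no proper subset of $Q$ is inversion-complete. -}

module Defs where

open import Data.Nat using (ℕ)
open import Data.Fin using (Fin) renaming (_<_ to _<ᶠ_)
open import Data.Fin.Permutation using (Permutation′; _⟨$⟩ʳ_)
open import Data.List using (List; length)
open import Data.List.Relation.Unary.Any using (Any)
open import Data.List.Relation.Unary.AllPairs using (AllPairs)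
open import Data.List.Relation.Binary.Sublist.Propositional using (_⊆_)
open import Data.Product using (∃₂; _×_)
open import Relation.Binary.PropositionalEquality using (_≡_)
open import Relation.Nullary using (¬_)
import Data.Nat as ℕ

-- S_n: permutations of [n], here of Fin n (0-based; order-preserving relabelling).
Perm : ℕ → Set
Perm n = Permutation′ n

_≈ₚ_ : ∀ {n} → Perm n → Perm n → Set
π ≈ₚ σ = ∀ i → π ⟨$⟩ʳ i ≡ σ ⟨$⟩ʳ i

-- A finite subset of S_n is a duplicate-free list of permutations.
Distinct : ∀ {n} → List (Perm n) → Set
Distinct = AllPairs (λ π σ → ¬ (π ≈ₚ σ))

Covers : ∀ {n} → Perm n → Fin n → Fin n → Set
Covers π a b = ∃₂ λ k l → k <ᶠ l × π ⟨$⟩ʳ k ≡ a × π ⟨$⟩ʳ l ≡ b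

InversionComplete : ∀ {n} → List (Perm n) → Set
InversionComplete {n} Q = ∀ (i j : Fin n) → i <ᶠ j → Any (λ π → Covers π j i) Q

-- Minimally inversion-complete: inversion-complete, and no proper subset is.
-- Proper subsets of (duplicate-free) Q are the sublists of Q of strictly smaller length.
MinInversionComplete : ∀ {n} → List (Perm n) → Set
MinInversionComplete Q =
  InversionComplete Q ×
  (∀ R → R ⊆ Q → length R ℕ.< length Q → ¬ InversionComplete R)

-- Minimality gives every member of Q a private inversion: one that no other member covers.
-- Taken as edges on [n], the private inversions of distinct members are distinct, and they
-- form a triangle-free graph: if (j , i), (k , j) and (k , i) with i < j < k were private
-- to ρ, σ and τ, then τ, which puts k before i, puts j either before i or after k, and so
-- covers an inversion private to ρ or to σ. Mantel's theorem bounds the number of edges by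
-- n²/4; it follows from 2·Σ deg² ≤ n·Σ deg (adjacent vertices have disjoint neighbourhoods)
-- together with the Cauchy–Schwarz inequality (Σ deg)² ≤ n·Σ deg².
module Submission where

open import Defs

open import Data.Empty using (⊥; ⊥-elim)
open import Data.Fin using (Fin; zero; suc) renaming (_<_ to _<ᶠ_)
open import Data.Fin.Permutation using (_⟨$⟩ˡ_; inverseˡ; inverseʳ)
import Data.Fin.Properties as Fin
open import Data.List using (List; _∷_; length; lookup; removeAt)
open import Data.List.Membership.Propositional using (lose)
open import Data.List.Membership.Propositional.Properties using (∈-lookup)
open import Data.List.Properties using (length-removeAt′)
open import Data.List.Relation.Binary.Sublist.Propositional using (_⊆_; ⊆-refl; _∷ʳ_; _∷_)
open import Data.List.Relation.Unary.Any using (Any; here; there; any?)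
open import Data.List.Relation.Unary.Any.Properties using (lookup-index)
open import Data.Nat
open import Data.Nat.DivMod using (_/_; m*n/n≡m; /-monoˡ-≤)
open import Data.Nat.Properties
open import Data.Nat.Tactic.RingSolver using (solve-∀)
open import Data.Product as Σ using (∃; ∃₂; _×_; _,_)
open import Data.Sum using (_⊎_; inj₁; inj₂)
open import Function using (_∘_; id)
open import Relation.Binary.PropositionalEquality
open import Relation.Nullary using (¬_; Dec; yes; no)
open import Relation.Nullary.Decidable using (map′; _→-dec_)

open import Algebra.Properties.CommutativeSemigroup *-commutativeSemigroup using (x∙yz≈y∙xz)
open import Algebra.Properties.Semiring.Sum +-*-semiring
  using (sum; sum-syntax; sum-cong-≗; sum-replicate-zero; ∑-distrib-+; ∑-comm; *-distribˡ-sum; *-distribʳ-sum)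

open ≤-Reasoning

0<m*n⇒0<m : ∀ m {n} → 0 < m * n → 0 < m
0<m*n⇒0<m (suc m) _ = z<s

0<m*n⇒0<n : ∀ m {n} → 0 < m * n → 0 < n
0<m*n⇒0<n m {n} p = 0<m*n⇒0<m n (subst (0 <_) (*-comm m n) p)

0<m+n⇒0<m⊎0<n : ∀ m {n} → 0 < m + n → 0 < m ⊎ 0 < n
0<m+n⇒0<m⊎0<n zero    p = inj₂ p
0<m+n⇒0<m⊎0<n (suc m) _ = inj₁ z<s

exclusive⇒m+n≤1 : ∀ {m n} → m ≤ 1 → n ≤ 1 → (0 < m → 0 < n → ⊥) → m + n ≤ 1
exclusive⇒m+n≤1 {zero}        _ n≤1 _     = n≤1
exclusive⇒m+n≤1 {1} {zero}    _ _   _     = s≤s z≤n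
exclusive⇒m+n≤1 {1} {suc _}   _ _   ¬both = ⊥-elim (¬both z<s z<s)
exclusive⇒m+n≤1 {suc (suc _)} (s≤s ())

2mn≤m²+n² : ∀ m n → 2 * (m * n) ≤ m * m + n * n
2mn≤m²+n² zero    n       = z≤n
2mn≤m²+n² (suc m) zero    = ≤-trans (≤-reflexive (cong (2 *_) (*-zeroʳ (suc m)))) z≤n
2mn≤m²+n² (suc m) (suc n) = begin
  2 * (suc m * suc n)             ≡⟨ lhs m n ⟩
  2 * (m * n) + 2 * (m + n + 1)   ≤⟨ +-monoˡ-≤ (2 * (m + n + 1)) (2mn≤m²+n² m n) ⟩
  m * m + n * n + 2 * (m + n + 1) ≡⟨ rhs m n ⟩
  suc m * suc m + suc n * suc n   ∎
  where
  lhs : ∀ m n → 2 * (suc m * suc n) ≡ 2 * (m * n) + 2 * (m + n + 1)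
  lhs = solve-∀
  rhs : ∀ m n → m * m + n * n + 2 * (m + n + 1) ≡ suc m * suc m + suc n * suc n
  rhs = solve-∀

d²≤ns⇒2s≤nd⇒2d≤n² : ∀ n d s → d * d ≤ n * s → 2 * s ≤ n * d → 2 * d ≤ n * n
d²≤ns⇒2s≤nd⇒2d≤n² n zero      s _     _     = z≤n
d²≤ns⇒2s≤nd⇒2d≤n² n d@(suc _) s d²≤ns 2s≤nd = *-cancelʳ-≤ (2 * d) (n * n) d (begin
  2 * d * d   ≡⟨ *-assoc 2 d d ⟩
  2 * (d * d) ≤⟨ *-monoʳ-≤ 2 d²≤ns ⟩
  2 * (n * s) ≡⟨ x∙yz≈y∙xz 2 n s ⟩
  n * (2 * s) ≤⟨ *-monoʳ-≤ n 2s≤nd ⟩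
  n * (n * d) ≡⟨ *-assoc n n d ⟨
  n * n * d   ∎)

∑-const : ∀ n c → ∑[ i < n ] c ≡ n * c
∑-const zero    c = refl
∑-const (suc n) c = cong (c +_) (∑-const n c)

∑-zero : ∀ {n} {f : Fin n → ℕ} → (∀ i → f i ≡ 0) → sum f ≡ 0
∑-zero {n} f≗0 = trans (sum-cong-≗ f≗0) (sum-replicate-zero n)

∑-mono-≤ : ∀ {n} {f g : Fin n → ℕ} → (∀ i → f i ≤ g i) → sum f ≤ sum g
∑-mono-≤ {zero}  _   = z≤n
∑-mono-≤ {suc n} f≤g = +-mono-≤ (f≤g zero) (∑-mono-≤ (f≤g ∘ suc))

0<∑⇒∃0< : ∀ {n} (f : Fin n → ℕ) → 0 < sum f → ∃ λ i → 0 < f i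
0<∑⇒∃0< {suc n} f 0<∑ with 0 <? f zero
... | yes 0<f₀ = zero , 0<f₀
... | no  0≮f₀ = Σ.map suc id (0<∑⇒∃0< (f ∘ suc) 0<∑f∘suc)
  where
  0<∑f∘suc : 0 < sum (f ∘ suc)
  0<∑f∘suc = subst (λ v → 0 < v + sum (f ∘ suc)) (n≤0⇒n≡0 (≮⇒≥ 0≮f₀)) 0<∑

∑≤1 : ∀ {n} (f : Fin n → ℕ) → (∀ i → f i ≤ 1) →
      (∀ {i j} → 0 < f i → 0 < f j → i ≡ j) → sum f ≤ 1
∑≤1 {zero}  f f≤1 unique = z≤n
∑≤1 {suc n} f f≤1 unique with 0 <? f zero
... | yes 0<f₀ = begin
  f zero + sum (f ∘ suc) ≡⟨ cong (f zero +_) (∑-zero rest≡0) ⟩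
  f zero + 0             ≡⟨ +-identityʳ (f zero) ⟩
  f zero                 ≤⟨ f≤1 zero ⟩
  1                      ∎
  where
  rest≡0 : ∀ i → f (suc i) ≡ 0
  rest≡0 i = n≤0⇒n≡0 (≮⇒≥ (λ 0<fᵢ → Fin.0≢1+n (unique 0<f₀ 0<fᵢ)))
... | no 0≮f₀ = begin
  f zero + sum (f ∘ suc) ≡⟨ cong (_+ sum (f ∘ suc)) (n≤0⇒n≡0 (≮⇒≥ 0≮f₀)) ⟩
  sum (f ∘ suc)          ≤⟨ ∑≤1 (f ∘ suc) (f≤1 ∘ suc) (λ p q → Fin.suc-injective (unique p q)) ⟩
  1                      ∎

∑*∑≡∑∑ : ∀ {n} (f g : Fin n → ℕ) → sum f * sum g ≡ ∑[ i < n ] ∑[ j < n ] (f i * g j)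
∑*∑≡∑∑ f g = trans (*-distribʳ-sum (sum g) f) (sum-cong-≗ (λ i → *-distribˡ-sum (f i) g))

∑-cauchy-schwarz : ∀ {n} (f : Fin n → ℕ) → sum f * sum f ≤ n * ∑[ i < n ] (f i * f i)
∑-cauchy-schwarz {n} f = *-cancelˡ-≤ 2 (begin
  2 * (sum f * sum f)                           ≡⟨ cong (2 *_) (∑*∑≡∑∑ f f) ⟩
  2 * ∑[ i < n ] ∑[ j < n ] (f i * f j)         ≡⟨ *-distribˡ-sum 2 (λ i → ∑[ j < n ] (f i * f j)) ⟩
  ∑[ i < n ] (2 * ∑[ j < n ] (f i * f j))       ≡⟨ sum-cong-≗ (λ i → *-distribˡ-sum 2 (λ j → f i * f j)) ⟩
  ∑[ i < n ] ∑[ j < n ] (2 * (f i * f j))       ≤⟨ ∑-mono-≤ (λ i → ∑-mono-≤ (λ j → 2mn≤m²+n² (f i) (f j))) ⟩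
  ∑[ i < n ] ∑[ j < n ] (f i * f i + f j * f j) ≡⟨ sum-cong-≗ (λ i → ∑-distrib-+ (λ _ → f i * f i) (λ j → f j * f j)) ⟩
  ∑[ i < n ] (∑[ j < n ] (f i * f i) + q)       ≡⟨ sum-cong-≗ (λ i → cong (_+ q) (∑-const n (f i * f i))) ⟩
  ∑[ i < n ] (n * (f i * f i) + q)              ≡⟨ ∑-distrib-+ (λ i → n * (f i * f i)) (λ _ → q) ⟩
  ∑[ i < n ] (n * (f i * f i)) + ∑[ i < n ] q   ≡⟨ cong₂ _+_ (*-distribˡ-sum n (λ i → f i * f i)) (sym (∑-const n q)) ⟨
  n * q + n * q                                 ≡⟨ cong (n * q +_) (+-identityʳ (n * q)) ⟨
  2 * (n * q)                                   ∎)
  where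
  q : ℕ
  q = ∑[ i < n ] (f i * f i)

δ : ∀ {n} → Fin n → Fin n → ℕ
δ zero    zero    = 1
δ zero    (suc _) = 0
δ (suc _) zero    = 0
δ (suc a) (suc x) = δ a x

δ≤1 : ∀ {n} (a x : Fin n) → δ a x ≤ 1
δ≤1 zero    zero    = s≤s z≤n
δ≤1 zero    (suc _) = z≤n
δ≤1 (suc _) zero    = z≤n
δ≤1 (suc a) (suc x) = δ≤1 a x

0<δ⇒≡ : ∀ {n} {a x : Fin n} → 0 < δ a x → a ≡ x
0<δ⇒≡ {a = zero}  {zero}  _ = refl
0<δ⇒≡ {a = suc a} {suc x} p = cong suc (0<δ⇒≡ p)

∑-δ : ∀ {n} (a : Fin n) (g : Fin n → ℕ) → ∑[ x < n ] (δ a x * g x) ≡ g a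
∑-δ {suc n} zero    g = begin-equality
  1 * g zero + ∑[ x < n ] (δ zero (suc x) * g (suc x)) ≡⟨ cong (1 * g zero +_) (∑-zero {f = λ x → δ zero (suc x) * g (suc x)} (λ _ → refl)) ⟩
  1 * g zero + 0                                       ≡⟨ +-identityʳ (1 * g zero) ⟩
  1 * g zero                                           ≡⟨ *-identityˡ (g zero) ⟩
  g zero                                               ∎
∑-δ {suc n} (suc a) g = ∑-δ a (g ∘ suc)

∑δ≡1 : ∀ {n} (a : Fin n) → sum (δ a) ≡ 1
∑δ≡1 a = trans (sum-cong-≗ (λ x → sym (*-identityʳ (δ a x)))) (∑-δ a (λ _ → 1))

∑∑δ*δ≡1 : ∀ {n} (a b : Fin n) → ∑[ x < n ] ∑[ y < n ] (δ a x * δ b y) ≡ 1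
∑∑δ*δ≡1 {n} a b = begin-equality
  ∑[ x < n ] ∑[ y < n ] (δ a x * δ b y) ≡⟨ sum-cong-≗ (λ x → *-distribˡ-sum (δ a x) (δ b)) ⟨
  ∑[ x < n ] (δ a x * sum (δ b))        ≡⟨ sum-cong-≗ (λ x → cong (δ a x *_) (∑δ≡1 b)) ⟩
  ∑[ x < n ] (δ a x * 1)                ≡⟨ ∑-δ a (λ _ → 1) ⟩
  1                                     ∎

-- For a 0/1 matrix A the last hypothesis says that the graph is triangle-free;
-- ∑∑ A counts every edge twice, so `mantel` is the bound 4·#edges ≤ n².
module Mantel {n : ℕ} (A : Fin n → Fin n → ℕ) (A-sym : ∀ x y → A x y ≡ A y x)
  (adjacent⇒disjoint : ∀ {a b} → 0 < A a b → ∀ y → A a y + A b y ≤ 1) where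

  deg : Fin n → ℕ
  deg x = ∑[ y < n ] A x y

  adjacent⇒deg+deg≤n : ∀ {a b} → 0 < A a b → deg a + deg b ≤ n
  adjacent⇒deg+deg≤n {a} {b} 0<Aab = begin
    deg a + deg b              ≡⟨ ∑-distrib-+ (A a) (A b) ⟨
    ∑[ y < n ] (A a y + A b y) ≤⟨ ∑-mono-≤ (adjacent⇒disjoint 0<Aab) ⟩
    ∑[ y < n ] 1               ≡⟨ ∑-const n 1 ⟩
    n * 1                      ≡⟨ *-identityʳ n ⟩
    n                          ∎

  A*[deg+deg]≤A*n : ∀ x y → A x y * (deg x + deg y) ≤ A x y * n
  A*[deg+deg]≤A*n x y with A x y in eq
  ... | zero  = z≤n
  ... | suc k = *-monoʳ-≤ (suc k) (adjacent⇒deg+deg≤n (subst (0 <_) (sym eq) z<s))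

  ∑deg²≡∑∑A*deg-row : ∑[ x < n ] (deg x * deg x) ≡ ∑[ x < n ] ∑[ y < n ] (A x y * deg x)
  ∑deg²≡∑∑A*deg-row = sum-cong-≗ (λ x → *-distribʳ-sum (deg x) (A x))

  ∑deg²≡∑∑A*deg-col : ∑[ x < n ] (deg x * deg x) ≡ ∑[ x < n ] ∑[ y < n ] (A x y * deg y)
  ∑deg²≡∑∑A*deg-col = begin-equality
    ∑[ x < n ] (deg x * deg x)            ≡⟨ ∑deg²≡∑∑A*deg-row ⟩
    ∑[ x < n ] ∑[ y < n ] (A x y * deg x) ≡⟨ ∑-comm (λ x y → A x y * deg x) ⟩
    ∑[ y < n ] ∑[ x < n ] (A x y * deg x) ≡⟨ sum-cong-≗ (λ y → sum-cong-≗ (λ x → cong (_* deg x) (A-sym x y))) ⟩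
    ∑[ y < n ] ∑[ x < n ] (A y x * deg x) ∎

  2∑deg²≤n∑deg : 2 * ∑[ x < n ] (deg x * deg x) ≤ n * sum deg
  2∑deg²≤n∑deg = begin
    2 * s                                                   ≡⟨ cong (s +_) (+-identityʳ s) ⟩
    s + s                                                   ≡⟨ cong₂ _+_ ∑deg²≡∑∑A*deg-row ∑deg²≡∑∑A*deg-col ⟩
    ∑[ x < n ] ∑[ y < n ] (A x y * deg x) + ∑[ x < n ] ∑[ y < n ] (A x y * deg y)
      ≡⟨ ∑-distrib-+ (λ x → ∑[ y < n ] (A x y * deg x)) (λ x → ∑[ y < n ] (A x y * deg y)) ⟨
    ∑[ x < n ] (∑[ y < n ] (A x y * deg x) + ∑[ y < n ] (A x y * deg y))
      ≡⟨ sum-cong-≗ (λ x → ∑-distrib-+ (λ y → A x y * deg x) (λ y → A x y * deg y)) ⟨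
    ∑[ x < n ] ∑[ y < n ] (A x y * deg x + A x y * deg y)
      ≡⟨ sum-cong-≗ (λ x → sum-cong-≗ (λ y → *-distribˡ-+ (A x y) (deg x) (deg y))) ⟨
    ∑[ x < n ] ∑[ y < n ] (A x y * (deg x + deg y))         ≤⟨ ∑-mono-≤ (λ x → ∑-mono-≤ (A*[deg+deg]≤A*n x)) ⟩
    ∑[ x < n ] ∑[ y < n ] (A x y * n)                       ≡⟨ sum-cong-≗ (λ x → *-distribʳ-sum n (A x)) ⟨
    ∑[ x < n ] (deg x * n)                                  ≡⟨ *-distribʳ-sum n deg ⟨
    sum deg * n                                             ≡⟨ *-comm (sum deg) n ⟩
    n * sum deg                                             ∎
    where
    s : ℕ
    s = ∑[ x < n ] (deg x * deg x)

  mantel : 2 * ∑[ x < n ] ∑[ y < n ] A x y ≤ n * n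
  mantel = d²≤ns⇒2s≤nd⇒2d≤n² n (sum deg) _ (∑-cauchy-schwarz deg) 2∑deg²≤n∑deg

module EdgeList {n m : ℕ} (src tgt : Fin m → Fin n) where

  Arc : Fin n → Fin n → Set
  Arc x y = ∃ λ z → src z ≡ x × tgt z ≡ y

  Adjacent : Fin n → Fin n → Set
  Adjacent x y = Arc x y ⊎ Arc y x

  arc : Fin m → Fin n → Fin n → ℕ
  arc z x y = δ (src z) x * δ (tgt z) y

  arcs : Fin n → Fin n → ℕ
  arcs x y = ∑[ z < m ] arc z x y

  0<arc⇒≡ : ∀ z {x y} → 0 < arc z x y → src z ≡ x × tgt z ≡ y
  0<arc⇒≡ z p = 0<δ⇒≡ (0<m*n⇒0<m (δ (src z) _) p) , 0<δ⇒≡ (0<m*n⇒0<n (δ (src z) _) p)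

  0<arcs⇒Arc : ∀ {x y} → 0 < arcs x y → Arc x y
  0<arcs⇒Arc p = let z , q = 0<∑⇒∃0< _ p in z , 0<arc⇒≡ z q

  ∑∑arcs≡m : ∑[ x < n ] ∑[ y < n ] arcs x y ≡ m
  ∑∑arcs≡m = begin-equality
    ∑[ x < n ] ∑[ y < n ] ∑[ z < m ] arc z x y ≡⟨ sum-cong-≗ (λ x → ∑-comm (λ y z → arc z x y)) ⟩
    ∑[ x < n ] ∑[ z < m ] ∑[ y < n ] arc z x y ≡⟨ ∑-comm (λ x z → ∑[ y < n ] arc z x y) ⟩
    ∑[ z < m ] ∑[ x < n ] ∑[ y < n ] arc z x y ≡⟨ sum-cong-≗ (λ z → ∑∑δ*δ≡1 (src z) (tgt z)) ⟩
    ∑[ z < m ] 1                               ≡⟨ ∑-const m 1 ⟩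
    m * 1                                      ≡⟨ *-identityʳ m ⟩
    m                                          ∎

  module TriangleFree
    (src<tgt : ∀ z → src z <ᶠ tgt z)
    (edge-injective : ∀ {z z′} → src z ≡ src z′ → tgt z ≡ tgt z′ → z ≡ z′)
    (no-transitive-triangle : ∀ {i j k} → Arc i j → Arc j k → Arc i k → ⊥)
    where

    Arc⇒< : ∀ {x y} → Arc x y → x <ᶠ y
    Arc⇒< (z , refl , refl) = src<tgt z

    no-cycle : ∀ {i j k} → Arc i j → Arc j k → Arc k i → ⊥
    no-cycle ij jk ki = Fin.<-irrefl refl (Fin.<-trans (Arc⇒< ij) (Fin.<-trans (Arc⇒< jk) (Arc⇒< ki)))

    no-triangle : ∀ {a b c} → Adjacent a b → Adjacent a c → Adjacent b c → ⊥
    no-triangle (inj₁ ab) (inj₁ ac) (inj₁ bc) = no-transitive-triangle ab bc ac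
    no-triangle (inj₁ ab) (inj₁ ac) (inj₂ cb) = no-transitive-triangle ac cb ab
    no-triangle (inj₁ ab) (inj₂ ca) (inj₁ bc) = no-cycle ab bc ca
    no-triangle (inj₁ ab) (inj₂ ca) (inj₂ cb) = no-transitive-triangle ca ab cb
    no-triangle (inj₂ ba) (inj₁ ac) (inj₁ bc) = no-transitive-triangle ba ac bc
    no-triangle (inj₂ ba) (inj₁ ac) (inj₂ cb) = no-cycle ba ac cb
    no-triangle (inj₂ ba) (inj₂ ca) (inj₁ bc) = no-transitive-triangle bc ca ba
    no-triangle (inj₂ ba) (inj₂ ca) (inj₂ cb) = no-transitive-triangle cb ba ca

    arcs≤1 : ∀ x y → arcs x y ≤ 1
    arcs≤1 x y = ∑≤1 (λ z → arc z x y) (λ z → *-mono-≤ (δ≤1 (src z) x) (δ≤1 (tgt z) y)) same-edge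
      where
      same-edge : ∀ {z z′} → 0 < arc z x y → 0 < arc z′ x y → z ≡ z′
      same-edge {z} {z′} p q with 0<arc⇒≡ z p | 0<arc⇒≡ z′ q
      ... | refl , refl | src≡ , tgt≡ = edge-injective (sym src≡) (sym tgt≡)

    adj : Fin n → Fin n → ℕ
    adj x y = arcs x y + arcs y x

    0<adj⇒Adjacent : ∀ {x y} → 0 < adj x y → Adjacent x y
    0<adj⇒Adjacent {x} {y} p with 0<m+n⇒0<m⊎0<n (arcs x y) p
    ... | inj₁ q = inj₁ (0<arcs⇒Arc q)
    ... | inj₂ q = inj₂ (0<arcs⇒Arc q)

    adj≤1 : ∀ x y → adj x y ≤ 1
    adj≤1 x y = exclusive⇒m+n≤1 (arcs≤1 x y) (arcs≤1 y x)
      (λ p q → Fin.<-asym (Arc⇒< (0<arcs⇒Arc p)) (Arc⇒< (0<arcs⇒Arc q)))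

    adjacent⇒disjoint : ∀ {a b} → 0 < adj a b → ∀ y → adj a y + adj b y ≤ 1
    adjacent⇒disjoint ab y = exclusive⇒m+n≤1 (adj≤1 _ y) (adj≤1 _ y)
      (λ ay by → no-triangle (0<adj⇒Adjacent ab) (0<adj⇒Adjacent ay) (0<adj⇒Adjacent by))

    ∑∑adj≡m+m : ∑[ x < n ] ∑[ y < n ] adj x y ≡ m + m
    ∑∑adj≡m+m = begin-equality
      ∑[ x < n ] ∑[ y < n ] adj x y
        ≡⟨ sum-cong-≗ (λ x → ∑-distrib-+ (arcs x) (λ y → arcs y x)) ⟩
      ∑[ x < n ] (∑[ y < n ] arcs x y + ∑[ y < n ] arcs y x)
        ≡⟨ ∑-distrib-+ (λ x → ∑[ y < n ] arcs x y) (λ x → ∑[ y < n ] arcs y x) ⟩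
      ∑[ x < n ] ∑[ y < n ] arcs x y + ∑[ x < n ] ∑[ y < n ] arcs y x
        ≡⟨ cong₂ _+_ ∑∑arcs≡m (trans (∑-comm (λ x y → arcs y x)) ∑∑arcs≡m) ⟩
      m + m
        ∎

    4m≤n² : 4 * m ≤ n * n
    4m≤n² = begin
      4 * m                             ≡⟨ double m ⟩
      2 * (m + m)                       ≡⟨ cong (2 *_) ∑∑adj≡m+m ⟨
      2 * ∑[ x < n ] ∑[ y < n ] adj x y ≤⟨ Mantel.mantel adj (λ x y → +-comm (arcs x y) (arcs y x)) adjacent⇒disjoint ⟩
      n * n                             ∎
      where
      double : ∀ m → 4 * m ≡ 2 * (m + m)
      double = solve-∀

module _ {n} (π : Perm n) where

  covers⇒< : ∀ {a b} → Covers π a b → π ⟨$⟩ˡ a <ᶠ π ⟨$⟩ˡ b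
  covers⇒< (k , l , k<l , refl , refl) rewrite inverseˡ π {k} | inverseˡ π {l} = k<l

  <⇒covers : ∀ {a b} → π ⟨$⟩ˡ a <ᶠ π ⟨$⟩ˡ b → Covers π a b
  <⇒covers a<b = _ , _ , a<b , inverseʳ π , inverseʳ π

  covers? : ∀ a b → Dec (Covers π a b)
  covers? a b = map′ <⇒covers covers⇒< (π ⟨$⟩ˡ a Fin.<? π ⟨$⟩ˡ b)

  covers-split : ∀ {i k} → Covers π k i → ∀ j → Covers π j i ⊎ Covers π k j
  covers-split ki j with π ⟨$⟩ˡ j Fin.<? π ⟨$⟩ˡ _
  ... | yes j<i = inj₁ (<⇒covers j<i)
  ... | no  j≮i = inj₂ (<⇒covers (<-≤-trans (covers⇒< ki) (≮⇒≥ j≮i)))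

module _ {n} (R : List (Perm n)) where

  covered-if-inversion? : ∀ i j → Dec (i <ᶠ j → Any (λ π → Covers π j i) R)
  covered-if-inversion? i j = (i Fin.<? j) →-dec any? (λ π → covers? π j i) R

  ¬complete⇒uncovered : ¬ InversionComplete R → ∃₂ λ i j → i <ᶠ j × ¬ Any (λ π → Covers π j i) R
  ¬complete⇒uncovered incomplete
    with Fin.¬∀⟶∃¬ n _ (λ i → Fin.all? (covered-if-inversion? i)) (λ all → incomplete (λ i j → all i j))
  ... | i , ¬∀j with Fin.¬∀⟶∃¬ n _ (covered-if-inversion? i) ¬∀j
  ... | j , ¬covered with i Fin.<? j
  ... | yes i<j = i , j , i<j , λ any → ¬covered (λ _ → any)
  ... | no  i≮j = ⊥-elim (¬covered (λ i<j → ⊥-elim (i≮j i<j)))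

removeAt-⊆ : ∀ {A : Set} (xs : List A) i → removeAt xs i ⊆ xs
removeAt-⊆ (x ∷ xs) zero    = x ∷ʳ ⊆-refl
removeAt-⊆ (x ∷ xs) (suc i) = refl ∷ removeAt-⊆ xs i

Any-removeAt⁺ : ∀ {A : Set} {P : A → Set} (xs : List A) {i j} →
                j ≢ i → P (lookup xs j) → Any P (removeAt xs i)
Any-removeAt⁺ (x ∷ xs) {zero}  {zero}  j≢i _ = ⊥-elim (j≢i refl)
Any-removeAt⁺ (x ∷ xs) {zero}  {suc j} _   p = lose (∈-lookup j) p
Any-removeAt⁺ (x ∷ xs) {suc i} {zero}  _   p = here p
Any-removeAt⁺ (x ∷ xs) {suc i} {suc j} j≢i p = there (Any-removeAt⁺ xs (j≢i ∘ cong suc) p)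

module MinimallyComplete {n} (Q : List (Perm n)) (complete : InversionComplete Q)
  (minimal : ∀ R → R ⊆ Q → length R < length Q → ¬ InversionComplete R) where

  record PrivateInversion (z : Fin (length Q)) : Set where
    field
      lo hi   : Fin n
      lo<hi   : lo <ᶠ hi
      covered : Covers (lookup Q z) hi lo
      only    : ∀ z′ → Covers (lookup Q z′) hi lo → z′ ≡ z

  opaque
    private-inversion : ∀ z → PrivateInversion z
    private-inversion z with ¬complete⇒uncovered (removeAt Q z)
                               (minimal _ (removeAt-⊆ Q z) (≤-reflexive (sym (length-removeAt′ Q z))))
    ... | i , j , i<j , uncovered = record
      { lo = i ; hi = j ; lo<hi = i<j
      ; covered = subst (λ z′ → Covers (lookup Q z′) j i) (only _ (lookup-index witness)) (lookup-index witness)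
      ; only = only
      }
      where
      witness : Any (λ π → Covers π j i) Q
      witness = complete i j i<j
      only : ∀ z′ → Covers (lookup Q z′) j i → z′ ≡ z
      only z′ c with z′ Fin.≟ z
      ... | yes z′≡z = z′≡z
      ... | no  z′≢z = ⊥-elim (uncovered (Any-removeAt⁺ Q z′≢z c))

  open module P z = PrivateInversion (private-inversion z)

  open EdgeList lo hi using (Arc)

  edge-injective : ∀ {z z′} → lo z ≡ lo z′ → hi z ≡ hi z′ → z ≡ z′
  edge-injective {z} {z′} lo≡ hi≡ = only z′ z (subst₂ (Covers (lookup Q z)) hi≡ lo≡ (covered z))

  no-transitive-triangle : ∀ {i j k} → Arc i j → Arc j k → Arc i k → ⊥
  no-transitive-triangle (z₁ , refl , refl) (z₂ , lo₂≡hi₁ , refl) (z₃ , lo₃≡lo₁ , hi₃≡hi₂)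
    with covers-split (lookup Q z₃) (subst₂ (Covers (lookup Q z₃)) hi₃≡hi₂ lo₃≡lo₁ (covered z₃)) (hi z₁)
  ... | inj₁ c = Fin.<-irrefl (trans lo₂≡hi₁ (trans (cong hi (sym (only z₁ z₃ c))) hi₃≡hi₂)) (lo<hi z₂)
  ... | inj₂ c = Fin.<-irrefl (trans (trans (sym lo₃≡lo₁) (cong lo (only z₂ z₃ c′))) lo₂≡hi₁) (lo<hi z₁)
    where
    c′ : Covers (lookup Q z₃) (hi z₂) (lo z₂)
    c′ = subst (Covers (lookup Q z₃) (hi z₂)) (sym lo₂≡hi₁) c

  4*length≤n² : 4 * length Q ≤ n * n
  4*length≤n² = EdgeList.TriangleFree.4m≤n² lo hi lo<hi edge-injective no-transitive-triangle

corollary4 : ∀ (n : ℕ) → 2 ≤ n → (Q : List (Perm n)) → Distinct Q →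
    MinInversionComplete Q → length Q ≤ (n * n) / 4
corollary4 n _ Q _ (complete , minimal) = begin
  length Q         ≡⟨ m*n/n≡m (length Q) 4 ⟨
  length Q * 4 / 4 ≤⟨ /-monoˡ-≤ 4 (≤-trans (≤-reflexive (*-comm (length Q) 4)) 4*length≤n²) ⟩
  n * n / 4        ∎
  where
  open MinimallyComplete Q complete minimal using (4*length≤n²)
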